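{- Let $p$ be a prime and $x>1$ an integer. Then $I(x,p)=\frac{1+p^x}{p^x}$ is an abundancy outlaw, i.e. there is no positive integer $n$ with $\frac{\sigma(n)}{n}=\frac{1+p^x}{p^x}$.
   Context: For positive integers $x,n$, $\sigma_x(n)=\sum_{d\mid n} d^x$ and $I(x,n)=\sigma_x(n)/n^x$; $\sigma(n)=\sigma_1(n)$ is the ordinary sum of divisors. A rational number greater than one is an abundancy outlaw if it is not equal to $\sigma(n)/n$ for any positive integer $n$. -}

module Defs where

open import Data.Nat using (ℕ; zero; suc; _+_; _*_; _^_; NonZero)
open import Data.Nat.Divisibility using (_∣_; _∣?_)
open import Data.List using (List; map; filter; upTo)
open import Data.Nat.ListAction using (sum)
open import Data.Integer using (+_)
open import Data.Rational using (ℚ; _/_; _<_; 1ℚ)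
open import Relation.Binary.PropositionalEquality using (_≢_)
open import Data.Product using (_×_)

divisors : ℕ → List ℕ
divisors n = filter (_∣? n) (map suc (upTo n))

σ[_] : ℕ → ℕ → ℕ
σ[ x ] n = sum (map (λ d → d ^ x) (divisors n))

σ : ℕ → ℕ
σ n = σ[ 1 ] n

abundancy : (n : ℕ) → .{{NonZero n}} → ℚ
abundancy n = (+ σ n) / n

I : (x n : ℕ) → .{{NonZero (n ^ x)}} → ℚ
I x n = (+ σ[ x ] n) / (n ^ x)

-- a rational q is an abundancy outlaw if q ≠ σ(n)/n for every positive n
-- (the condition q > 1 is part of the paper's definition)
AbundancyOutlaw : ℚ → Set
AbundancyOutlaw q = (1ℚ < q) × ((n : ℕ) → .{{_ : NonZero n}} → abundancy n ≢ q)

module Submission where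

-- Write q = p^x.  Since the divisors of a prime p are
-- 1 and p, σ_x(p) = 1 + p^x, which gives the first component; and
-- 1 < (1+q)/q is immediate.  For the outlaw property we prove more: (1+q)/q
-- is an outlaw for every COMPOSITE q = a·b (a, b ≥ 2), and p^x with x ≥ 2 is
-- composite.  Suppose σ(n)/n = (1+q)/q.  As q and 1+q are coprime, cross
-- multiplication σ(n)·q = (1+q)·n forces q ∣ n, say n = k·q, and cancelling q
-- gives σ(n) = n + k.  But k < k·b < n are three distinct divisors of n, so
-- σ(n) ≥ k + k·b + n > n + k, a contradiction.

open import Defs
open import Data.Nat using (ℕ; _+_; _^_; _<_)
open import Data.Nat.Properties using (m^n≢0)
open import Data.Nat.Primality using (Prime; prime⇒nonZero)
open import Data.Integer using (+_)
open import Data.Rational using (_/_)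
open import Data.Product using (_×_)
open import Relation.Binary.PropositionalEquality using (_≡_)

open import Data.Nat using (zero; suc; _*_; _≤_; NonZero; z≤n; s≤s; s≤s⁻¹; nonTrivial⇒n>1; >-nonZero)
open import Data.Nat.Properties
  using (≤-refl; ≤-trans; ≤-reflexive; <-trans; <-irrefl; n<1+n; m≤n⇒m<n∨m≡n; m≤m+n; m≤n+m; m<n+m;
         m≤m*n; m<m*n; +-assoc; +-comm; +-identityʳ; +-monoˡ-≤; +-monoʳ-<; *-comm; *-identityˡ; *-identityʳ;
         *-cancelʳ-≡; m*n≢0; ^-identityʳ; ^-zeroˡ; module ≤-Reasoning)
open import Data.Nat.Divisibility using (_∣_; _∣?_; divides; ∣-refl; 1∣_)
open import Data.Nat.Coprimality as C using (Coprime; coprime-divisor; coprime-+; 1-coprimeTo)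
open import Data.Nat.Primality using (prime⇒nonTrivial; composite)
open import Data.List using (List; []; _∷_; _++_; [_]; map; filter; upTo)
open import Data.List.Properties using (filter-++; map-++; upTo-∷ʳ; filter-accept; filter-reject; ++-identityʳ)
open import Data.Nat.ListAction using (sum)
open import Data.Nat.ListAction.Properties using (sum-++)
open import Data.Rational as ℚ using (1ℚ; *<*)
open import Data.Rational.Properties using (normalize-coprime; normalize-injective-≃)
open import Data.Integer using (+<+)
open import Data.Product using (_,_)
open import Relation.Nullary using (¬_; yes; no)
open import Data.Sum using (inj₁; inj₂)
open import Relation.Binary.PropositionalEquality using (refl; sym; trans; cong; subst₂; subst; _≢_; module ≡-Reasoning)
open import Data.Nat.Solver using (module +-*-Solver)
open +-*-Solver using (solve; con; _:+_; _:*_; _:=_)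

candidates : ℕ → List ℕ
candidates m = map suc (upTo m)

candidates-suc : ∀ m → candidates (suc m) ≡ candidates m ++ [ suc m ]
candidates-suc m = trans (cong (map suc) (sym (upTo-∷ʳ m))) (map-++ suc (upTo m) [ m ])

divisorsUpTo : ℕ → ℕ → List ℕ
divisorsUpTo n m = filter (_∣? n) (candidates m)

divisorsUpTo-∣ : ∀ {n} m → suc m ∣ n → divisorsUpTo n (suc m) ≡ divisorsUpTo n m ++ [ suc m ]
divisorsUpTo-∣ {n} m d = begin
  filter (_∣? n) (candidates (suc m))                  ≡⟨ cong (filter (_∣? n)) (candidates-suc m) ⟩
  filter (_∣? n) (candidates m ++ [ suc m ])           ≡⟨ filter-++ (_∣? n) (candidates m) [ suc m ] ⟩
  divisorsUpTo n m ++ filter (_∣? n) [ suc m ]         ≡⟨ cong (divisorsUpTo n m ++_) (filter-accept (_∣? n) d) ⟩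
  divisorsUpTo n m ++ [ suc m ]                        ∎
  where open ≡-Reasoning

divisorsUpTo-∤ : ∀ {n} m → ¬ suc m ∣ n → divisorsUpTo n (suc m) ≡ divisorsUpTo n m
divisorsUpTo-∤ {n} m nd = begin
  filter (_∣? n) (candidates (suc m))                  ≡⟨ cong (filter (_∣? n)) (candidates-suc m) ⟩
  filter (_∣? n) (candidates m ++ [ suc m ])           ≡⟨ filter-++ (_∣? n) (candidates m) [ suc m ] ⟩
  divisorsUpTo n m ++ filter (_∣? n) [ suc m ]         ≡⟨ cong (divisorsUpTo n m ++_) (filter-reject (_∣? n) nd) ⟩
  divisorsUpTo n m ++ []                               ≡⟨ ++-identityʳ _ ⟩
  divisorsUpTo n m                                     ∎
  where open ≡-Reasoning

divisorsUpTo-prime : ∀ {p} → Prime p → ∀ m → suc m < p → divisorsUpTo p (suc m) ≡ [ 1 ]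
divisorsUpTo-prime {p} pr zero    _  = filter-accept (_∣? p) (1∣ p)
divisorsUpTo-prime {p} pr (suc m) lt =
  trans (divisorsUpTo-∤ (suc m) (λ d → Prime.notComposite pr (composite lt d)))
        (divisorsUpTo-prime pr m (<-trans (n<1+n (suc m)) lt))

divisors-prime : ∀ {p} → Prime p → divisors p ≡ 1 ∷ p ∷ []
divisors-prime {p} pr with nonTrivial⇒n>1 p {{prime⇒nonTrivial pr}}
... | s≤s {n = suc m} _ = trans (divisorsUpTo-∣ (suc m) ∣-refl)
                                (cong (_++ [ p ]) (divisorsUpTo-prime pr m ≤-refl))

σ-prime : ∀ {p} → Prime p → ∀ x → σ[ x ] p ≡ 1 + p ^ x
σ-prime {p} pr x rewrite divisors-prime pr | ^-zeroˡ x | +-identityʳ (p ^ x) = refl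

divisorSum : ℕ → ℕ → ℕ
divisorSum n m = sum (map (λ d → d ^ 1) (divisorsUpTo n m))

divisorSum-∣ : ∀ {n} m → suc m ∣ n → divisorSum n (suc m) ≡ divisorSum n m + suc m
divisorSum-∣ {n} m d = begin
  divisorSum n (suc m)                                   ≡⟨ cong sumPowers (divisorsUpTo-∣ m d) ⟩
  sumPowers (divisorsUpTo n m ++ [ suc m ])              ≡⟨ cong sum (map-++ power (divisorsUpTo n m) [ suc m ]) ⟩
  sum (map power (divisorsUpTo n m) ++ [ suc m ^ 1 ])    ≡⟨ sum-++ (map power (divisorsUpTo n m)) [ suc m ^ 1 ] ⟩
  divisorSum n m + (suc m ^ 1 + 0)                       ≡⟨ cong (_+_ (divisorSum n m)) (trans (+-identityʳ _) (^-identityʳ (suc m))) ⟩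
  divisorSum n m + suc m                                 ∎
  where
  open ≡-Reasoning
  power : ℕ → ℕ
  power d = d ^ 1
  sumPowers : List ℕ → ℕ
  sumPowers ds = sum (map power ds)

divisorSum-suc : ∀ n m → divisorSum n m ≤ divisorSum n (suc m)
divisorSum-suc n m with suc m ∣? n
... | yes d  = ≤-trans (m≤m+n _ _) (≤-reflexive (sym (divisorSum-∣ m d)))
... | no  nd = ≤-reflexive (cong (λ ds → sum (map (λ d → d ^ 1) ds)) (sym (divisorsUpTo-∤ m nd)))

divisorSum-mono : ∀ n {m m′} → m ≤ m′ → divisorSum n m ≤ divisorSum n m′
divisorSum-mono n {m′ = zero}  z≤n = ≤-refl
divisorSum-mono n {m′ = suc m′} le with m≤n⇒m<n∨m≡n le
... | inj₁ (s≤s lt) = ≤-trans (divisorSum-mono n lt) (divisorSum-suc n m′)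
... | inj₂ refl     = ≤-refl

divisor-contributes : ∀ {n e m} → suc e ∣ n → suc e ≤ m → divisorSum n e + suc e ≤ divisorSum n m
divisor-contributes {n} {e} d le = ≤-trans (≤-reflexive (sym (divisorSum-∣ e d))) (divisorSum-mono n le)

σ-three-divisors : ∀ {a b n} → 0 < a → a < b → b < n → a ∣ n → b ∣ n → a + (b + n) ≤ σ n
σ-three-divisors {suc a} {suc b} {suc n} _ a<b b<n a∣n b∣n = begin
  suc a + (suc b + suc n)                              ≡⟨ sym (+-assoc (suc a) (suc b) (suc n)) ⟩
  suc a + suc b + suc n                                ≤⟨ +-monoˡ-≤ (suc n) (+-monoˡ-≤ (suc b) a-below-b) ⟩
  divisorSum (suc n) b + suc b + suc n                 ≤⟨ +-monoˡ-≤ (suc n) (divisor-contributes b∣n (s≤s⁻¹ b<n)) ⟩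
  divisorSum (suc n) n + suc n                         ≡⟨ sym (divisorSum-∣ n ∣-refl) ⟩
  σ (suc n)                                            ∎
  where
  open ≤-Reasoning
  a-below-b : suc a ≤ divisorSum (suc n) b
  a-below-b = ≤-trans (m≤n+m (suc a) _) (divisor-contributes a∣n (s≤s⁻¹ a<b))

coprime-suc : ∀ q → Coprime (1 + q) q
coprime-suc q = subst (λ m → Coprime m q) (+-comm q 1) (coprime-+ (1-coprimeTo q))

one<[1+q]/q : ∀ q .{{_ : NonZero q}} → 1ℚ ℚ.< (+ (1 + q)) / q
one<[1+q]/q (suc q) rewrite normalize-coprime {2 + q} {q} (coprime-suc (suc q)) =
  *<* (+<+ (subst₂ _<_ (sym (*-identityˡ (suc q))) (sym (*-identityʳ (2 + q))) (n<1+n (suc q))))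

abundancy-cross : ∀ n q .{{_ : NonZero n}} .{{_ : NonZero q}} →
                  abundancy n ≡ (+ (1 + q)) / q → σ n * q ≡ (1 + q) * n
abundancy-cross (suc n) (suc q) = normalize-injective-≃ (σ (suc n)) (2 + q) (suc n) (suc q)

cross⇒divisible : ∀ {n q} → σ n * q ≡ (1 + q) * n → q ∣ n
cross⇒divisible {n} {q} cross =
  coprime-divisor (C.sym (coprime-suc q)) (divides (σ n) (sym cross))

cross⇒σ≡n+k : ∀ {n q k} .{{_ : NonZero q}} → σ n * q ≡ (1 + q) * n → n ≡ k * q → σ n ≡ k + n
cross⇒σ≡n+k {n} {q} {k} cross n≡kq = *-cancelʳ-≡ (σ n) (k + n) q (begin
  σ n * q                ≡⟨ cross ⟩
  (1 + q) * n            ≡⟨ cong (_*_ (1 + q)) n≡kq ⟩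
  (1 + q) * (k * q)      ≡⟨ solve 2 (λ k q → (con 1 :+ q) :* (k :* q) := (k :+ k :* q) :* q) refl k q ⟩
  (k + k * q) * q        ≡⟨ cong (λ m → (k + m) * q) (sym n≡kq) ⟩
  (k + n) * q            ∎)
  where open ≡-Reasoning

σ-multiple-bound : ∀ {k a b} → 0 < k → 2 ≤ a → 2 ≤ b →
                   k + (k * b + k * (a * b)) ≤ σ (k * (a * b))
σ-multiple-bound {k} {a} {b} 0<k 2≤a 2≤b =
  σ-three-divisors 0<k (m<m*n k b 2≤b) kb<n (divides (a * b) (*-comm k (a * b))) (divides a n≡a*kb)
  where
  instance
    k≢0 : NonZero k
    k≢0 = >-nonZero 0<k
    b≢0 : NonZero b
    b≢0 = >-nonZero (≤-trans (s≤s z≤n) 2≤b)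
    kb≢0 : NonZero (k * b)
    kb≢0 = m*n≢0 k b
  n≡a*kb : k * (a * b) ≡ a * (k * b)
  n≡a*kb = solve 3 (λ k a b → k :* (a :* b) := a :* (k :* b)) refl k a b
  kb<n : k * b < k * (a * b)
  kb<n = subst₂ _<_ refl (trans (*-comm (k * b) a) (sym n≡a*kb)) (m<m*n (k * b) a 2≤a)

σ-multiple≢ : ∀ {k a b} → 0 < k → 2 ≤ a → 2 ≤ b → σ (k * (a * b)) ≢ k + k * (a * b)
σ-multiple≢ {k} {a} {b} 0<k 2≤a 2≤b σ≡ = <-irrefl refl (begin-strict
  k + n                  <⟨ +-monoʳ-< k (m<n+m n (<-trans 0<k (m<m*n k b 2≤b))) ⟩
  k + (k * b + n)        ≤⟨ σ-multiple-bound 0<k 2≤a 2≤b ⟩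
  σ n                    ≡⟨ σ≡ ⟩
  k + n                  ∎)
  where
  open ≤-Reasoning
  n = k * (a * b)
  instance
    k≢0 : NonZero k
    k≢0 = >-nonZero 0<k

outlaw-composite : ∀ q .{{_ : NonZero q}} {a b} → 2 ≤ a → 2 ≤ b → q ≡ a * b →
                   AbundancyOutlaw ((+ (1 + q)) / q)
outlaw-composite q {a} {b} 2≤a 2≤b refl = one<[1+q]/q q , no-witness
  where
  no-witness : ∀ n .{{_ : NonZero n}} → abundancy n ≢ (+ (1 + q)) / q
  no-witness (suc n) eq = impossible (abundancy-cross (suc n) q eq)
    where
    impossible : σ (suc n) * q ≢ (1 + q) * suc n
    impossible cross with cross⇒divisible cross
    ... | divides zero    ()
    ... | divides (suc k) n≡kq =
      σ-multiple≢ {suc k} (s≤s z≤n) 2≤a 2≤b (subst (λ m → σ m ≡ suc k + m) n≡kq (cross⇒σ≡n+k cross n≡kq))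

mainTheorem14 : (p x : ℕ) (pr : Prime p) → 1 < x →
    let instance nz = m^n≢0 p x {{prime⇒nonZero pr}}
    in (I x p ≡ (+ (1 + p ^ x)) / (p ^ x))
    × AbundancyOutlaw ((+ (1 + p ^ x)) / (p ^ x))
mainTheorem14 p (suc (suc x)) pr (s≤s (s≤s z≤n)) =
  cong (λ s → (+ s) / (p ^ suc (suc x))) (σ-prime pr (suc (suc x))) ,
  outlaw-composite (p ^ suc (suc x)) p≥2 p^1+x≥2 refl
  where
  instance
    p≢0 : NonZero p
    p≢0 = prime⇒nonZero pr
    p^x≢0 : NonZero (p ^ x)
    p^x≢0 = m^n≢0 p x
    q≢0 : NonZero (p ^ suc (suc x))
    q≢0 = m^n≢0 p (suc (suc x))
  p≥2 : 2 ≤ p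
  p≥2 = nonTrivial⇒n>1 p {{prime⇒nonTrivial pr}}
  p^1+x≥2 : 2 ≤ p ^ suc x
  p^1+x≥2 = ≤-trans p≥2 (m≤m*n p (p ^ x))
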